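{- Let $G$ be a finite simple graph. For every sequence of pivots $\varphi$ applicable to $G$ there exists a reduced sequence of pivots $\varphi'$ applicable to $G$ with $\sup(\varphi)=\sup(\varphi')$, and therefore $G\varphi=G\varphi'$.
   Context: For a vertex $x$, $N'(x)=N(x)\cup\{x\}$. Pivot: for an edge $\{u,v\}$, let $V_1=N'(u)\setminus N'(v)$, $V_2=N'(v)\setminus N'(u)$, $V_3=N'(u)\cap N'(v)$; $G[uv]$ is obtained by toggling every pair $\{x,y\}$ with $x\in V_i$, $y\in V_j$, $i\neq j$. A sequence $[v_1v_2]\cdots[v_{n-1}v_n]$ is applicable to $G$ if each $\{v_i,v_{i+1}\}$ is an edge of the graph obtained by applying the preceding pivots; $G\varphi$ is the result. The support $\sup(\varphi)=\{v_1\}\oplus\cdots\oplus\{v_n\}$ (symmetric difference) is the set of vertices occurring an odd number of times. A sequence of pivots is reduced if no vertex occurs more than once in it. -}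

module Defs where

open import Data.Nat using (ℕ)
open import Data.Fin using (Fin; _≟_)
open import Data.Fin.Subset using (Subset; ⁅_⁆; ⊥)
open import Data.Bool using (Bool; true; false; _∧_; _∨_; not; _xor_)
open import Data.Vec using (zipWith)
open import Data.List using (List; []; _∷_)
open import Data.List.Relation.Unary.Unique.Propositional using (Unique)
open import Data.Product using (_×_; _,_)
open import Data.Unit using (⊤)
open import Relation.Nullary.Decidable using (⌊_⌋)
open import Relation.Binary.PropositionalEquality using (_≡_)

Adj : ℕ → Set
Adj n = Fin n → Fin n → Bool

record IsSimple {n : ℕ} (G : Adj n) : Set where
  field
    sym     : ∀ x y → G x y ≡ G y x
    loopless : ∀ x → G x x ≡ false

N' : ∀ {n} → Adj n → Fin n → Fin n → Bool
N' G u x = ⌊ x ≟ u ⌋ ∨ G u x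

-- Pivot G[uv]: with V1 = N'(u) \ N'(v), V2 = N'(v) \ N'(u), V3 = N'(u) ∩ N'(v),
-- toggle every pair {x,y} with x ∈ Vi, y ∈ Vj, i ≠ j.
-- A vertex x lies in V1 ∪ V2 ∪ V3 iff (x ∈ N'(u)) ∨ (x ∈ N'(v)), and the
-- index i of its class is determined by the pair (x ∈ N'(u), x ∈ N'(v)).
pivot : ∀ {n} → Adj n → Fin n → Fin n → Adj n
pivot {n} G u v x y = G x y xor toggle
  where
  inU inV : Fin n → Bool
  inU z = N' G u z
  inV z = N' G v z
  inSome : Fin n → Bool
  inSome z = inU z ∨ inV z
  differentClass : Bool
  differentClass = (inU x xor inU y) ∨ (inV x xor inV y)
  toggle : Bool
  toggle = inSome x ∧ inSome y ∧ differentClass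

PivotSeq : ℕ → Set
PivotSeq n = List (Fin n × Fin n)

apply : ∀ {n} → Adj n → PivotSeq n → Adj n
apply G []            = G
apply G ((u , v) ∷ φ) = apply (pivot G u v) φ

Applicable : ∀ {n} → Adj n → PivotSeq n → Set
Applicable G []            = ⊤
Applicable G ((u , v) ∷ φ) = (G u v ≡ true) × Applicable (pivot G u v) φ

vertices : ∀ {n} → PivotSeq n → List (Fin n)
vertices []            = []
vertices ((u , v) ∷ φ) = u ∷ v ∷ vertices φ

_⊕_ : ∀ {n} → Subset n → Subset n → Subset n
_⊕_ = zipWith _xor_

sup : ∀ {n} → PivotSeq n → Subset n
sup []            = ⊥
sup ((u , v) ∷ φ) = ⁅ u ⁆ ⊕ (⁅ v ⁆ ⊕ sup φ)

Reduced : ∀ {n} → PivotSeq n → Set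
Reduced φ = Unique (vertices φ)

module Submission where

-- We work over GF(2) = Bool with xor and ∧, and view a graph on Fin n as a
-- symmetric matrix.  For matrices A, B and a set X ⊆ Fin n (a 0/1 vector)
-- write  A ⟶[ X ] B  if, for every vector z, exchanging the X-coordinates of
-- the pair (z , A z) yields a pair (p , q) with q = B p.  (B is then the
-- principal pivot transform of A on X.)  This relation composes, with the
-- sets adding in GF(2), and the pair of relations A ⟶[ X ] B, B ⟶[ X ] A
-- determines B from A and X.
--
-- A pivot on an edge uv is the rank-two update A + a bᵀ + b aᵀ, where a and b
-- are the closed neighbourhoods of u and v, and a direct computation shows
-- that it is related to A in both directions by the set {u, v}.  Hence a
-- pivot sequence φ applicable to G relates G to G φ by the set sup φ.
-- Conversely, if G is related to some H by a set X ∋ u, then row u of G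
-- meets X in some v; pivoting on uv and recursing on the smaller set
-- X ⊕ {u, v} builds a reduced applicable sequence with support X.  Applying
-- this to X = sup φ, the uniqueness of the related matrix gives G φ = G φ′.

open import Defs
open import Level using (0ℓ)
open import Data.Nat using (ℕ; zero; suc; _<_)
open import Data.Nat.Induction using (<-wellFounded)
open import Induction.WellFounded using (Acc; acc)
open import Data.Fin using (Fin; zero; suc; _≟_)
open import Data.Fin.Properties using (any?)
open import Data.Fin.Subset using (⁅_⁆; ∣_∣) renaming (_∈_ to _∈ₛ_)
open import Data.Fin.Subset.Properties using (p⊂q⇒∣p∣<∣q∣)
open import Data.Bool using (Bool; true; false; not; _∧_; _∨_; _xor_)
import Data.Bool.Properties as Bool
open import Data.Bool.Properties
  using (xor-∧-commutativeRing; xor-comm; xor-assoc; xor-same; xor-identityʳ;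
         ∧-comm; ∧-assoc; ∧-distribʳ-xor; ¬-not)
open import Data.Vec using (Vec; lookup; tabulate)
open import Data.Vec.Properties
  using (lookup-zipWith; lookup-replicate; lookup∘tabulate; tabulate∘lookup;
         tabulate-cong; []=⇒lookup; lookup⇒[]=)
open import Data.Vec.Functional using (Vector)
open import Data.List using ([]; _∷_)
open import Data.List.Membership.Propositional using (_∈_)
open import Data.List.Relation.Unary.Any using (here; there)
open import Data.List.Relation.Unary.All as All using (All)
open import Data.List.Relation.Unary.AllPairs using ([]; _∷_)
open import Data.Product using (Σ; ∃; _×_; _,_; proj₁; proj₂)
open import Data.Unit using (tt)
open import Data.Empty using (⊥-elim)
open import Algebra using (CommutativeRing)
open import Relation.Nullary using (yes; no)
open import Relation.Nullary.Decidable using (⌊_⌋; _×-dec_; dec⇒maybe)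
open import Relation.Binary.PropositionalEquality
  using (_≡_; _≢_; _≗_; refl; sym; trans; cong; cong₂; module ≡-Reasoning)
open import Tactic.RingSolver.Core.AlmostCommutativeRing
  using (AlmostCommutativeRing; fromCommutativeRing)
open import Tactic.RingSolver using (solve-∀)
open import Algebra.Properties.Semiring.Sum
  (CommutativeRing.semiring xor-∧-commutativeRing)
  using (sum; ∑-distrib-+; *-distribˡ-sum; sum-cong-≗; sum-replicate-zero)

open ≡-Reasoning

-- The Boolean ring (Bool, xor, ∧) packaged for the ring solver; since its
-- coefficients are Booleans, the solver also knows that 1 + 1 = 0.
GF2 : AlmostCommutativeRing 0ℓ 0ℓ
GF2 = fromCommutativeRing xor-∧-commutativeRing (λ x → dec⇒maybe (false Bool.≟ x))

false≢true : false ≢ true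
false≢true ()

_≡ᴹ_ : ∀ {n} → Adj n → Adj n → Set
A ≡ᴹ B = ∀ x y → A x y ≡ B x y

_+ᵛ_ : ∀ {n} → Vector Bool n → Vector Bool n → Vector Bool n
(x +ᵛ y) i = x i xor y i

-- Unit vector at u, written with the same test as the closed neighbourhood N'.
δ : ∀ {n} → Fin n → Vector Bool n
δ u i = ⌊ i ≟ u ⌋

-- The indicator vector of {u, v} when u ≠ v.
pair : ∀ {n} → Fin n → Fin n → Vector Bool n
pair u v = δ u +ᵛ δ v

⟨_,_⟩ : ∀ {n} → Vector Bool n → Vector Bool n → Bool
⟨ f , z ⟩ = sum (λ j → f j ∧ z j)

_·_ : ∀ {n} → Adj n → Vector Bool n → Vector Bool n
(A · z) i = ⟨ A i , z ⟩

-- Basic facts about unit vectors; the successor case is needed because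
-- ⌊ suc i ≟ suc u ⌋ does not reduce to ⌊ i ≟ u ⌋ definitionally.
δ-refl : ∀ {n} (u : Fin n) → δ u u ≡ true
δ-refl u with u ≟ u
... | yes _   = refl
... | no u≢u = ⊥-elim (u≢u refl)

δ-other : ∀ {n} {u i : Fin n} → i ≢ u → δ u i ≡ false
δ-other {u = u} {i} i≢u with i ≟ u
... | yes i≡u = ⊥-elim (i≢u i≡u)
... | no _    = refl

δ-suc : ∀ {n} (u i : Fin n) → δ (suc u) (suc i) ≡ δ u i
δ-suc u i with i ≟ u
... | yes _ = refl
... | no _  = refl

δ-subst : ∀ {n} (u j : Fin n) (g : Vector Bool n) → δ u j ∧ g j ≡ δ u j ∧ g u
δ-subst u j g with j ≟ u
... | yes refl = refl
... | no _     = refl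

⟨⟩-comm : ∀ {n} (f z : Vector Bool n) → ⟨ f , z ⟩ ≡ ⟨ z , f ⟩
⟨⟩-comm f z = sum-cong-≗ (λ j → ∧-comm (f j) (z j))

⟨⟩-congʳ : ∀ {n} (f : Vector Bool n) {z z′ : Vector Bool n} → z ≗ z′ → ⟨ f , z ⟩ ≡ ⟨ f , z′ ⟩
⟨⟩-congʳ f z≗z′ = sum-cong-≗ (λ j → cong (f j ∧_) (z≗z′ j))

⟨⟩-+ˡ : ∀ {n} (f g z : Vector Bool n) → ⟨ f +ᵛ g , z ⟩ ≡ ⟨ f , z ⟩ xor ⟨ g , z ⟩
⟨⟩-+ˡ f g z = trans (sum-cong-≗ (λ j → ∧-distribʳ-xor (z j) (f j) (g j)))
                    (∑-distrib-+ (λ j → f j ∧ z j) (λ j → g j ∧ z j))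

⟨⟩-scaleˡ : ∀ {n} (c : Bool) (f z : Vector Bool n) → ⟨ (λ j → c ∧ f j) , z ⟩ ≡ c ∧ ⟨ f , z ⟩
⟨⟩-scaleˡ c f z = trans (sum-cong-≗ (λ j → ∧-assoc c (f j) (z j)))
                        (sym (*-distribˡ-sum c (λ j → f j ∧ z j)))

⟨δ,_⟩ : ∀ {n} {u : Fin n} (z : Vector Bool n) → ⟨ δ u , z ⟩ ≡ z u
⟨δ,_⟩ {suc n} {zero}  z = trans (cong (z zero xor_) (sum-replicate-zero n)) (xor-identityʳ (z zero))
⟨δ,_⟩ {suc n} {suc u} z = trans (sum-cong-≗ (λ j → cong (_∧ z (suc j)) (δ-suc u j)))
                                (⟨δ,_⟩ {u = u} (λ j → z (suc j)))

⟨⟩-two-point : ∀ {n} (f z : Vector Bool n) (u v : Fin n) (c d : Bool) →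
  ⟨ f , (λ j → z j xor ((δ u j ∧ c) xor (δ v j ∧ d))) ⟩ ≡ ⟨ f , z ⟩ xor ((f u ∧ c) xor (f v ∧ d))
⟨⟩-two-point f z u v c d = begin
  ⟨ f , z +ᵛ ((λ j → δ u j ∧ c) +ᵛ (λ j → δ v j ∧ d)) ⟩
    ≡⟨ ⟨⟩-comm f _ ⟩
  ⟨ z +ᵛ ((λ j → δ u j ∧ c) +ᵛ (λ j → δ v j ∧ d)) , f ⟩
    ≡⟨ trans (⟨⟩-+ˡ z _ f) (cong (⟨ z , f ⟩ xor_) (⟨⟩-+ˡ _ _ f)) ⟩
  ⟨ z , f ⟩ xor (⟨ (λ j → δ u j ∧ c) , f ⟩ xor ⟨ (λ j → δ v j ∧ d) , f ⟩)
    ≡⟨ cong₂ _xor_ (⟨⟩-comm z f) (cong₂ _xor_ (point u c) (point v d)) ⟩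
  ⟨ f , z ⟩ xor ((f u ∧ c) xor (f v ∧ d)) ∎
  where
  point : ∀ w e → ⟨ (λ j → δ w j ∧ e) , f ⟩ ≡ f w ∧ e
  point w e = begin
    ⟨ (λ j → δ w j ∧ e) , f ⟩ ≡⟨ sum-cong-≗ (λ j → trans (∧-assoc (δ w j) e (f j))
                                            (cong (δ w j ∧_) (∧-comm e (f j)))) ⟩
    ⟨ δ w , (λ j → f j ∧ e) ⟩ ≡⟨ ⟨δ, (λ j → f j ∧ e) ⟩ ⟩
    f w ∧ e                    ∎

·-cong : ∀ {n} (A : Adj n) {z z′ : Vector Bool n} → z ≗ z′ → A · z ≗ A · z′
·-cong A z≗z′ i = ⟨⟩-congʳ (A i) z≗z′

·-congᴹ : ∀ {n} {A B : Adj n} → A ≡ᴹ B → (z : Vector Bool n) → A · z ≗ B · z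
·-congᴹ A≡B z i = sum-cong-≗ (λ j → cong (_∧ z j) (A≡B i j))

·-δ : ∀ {n} (A : Adj n) (i j : Fin n) → (A · δ j) i ≡ A i j
·-δ A i j = trans (⟨⟩-comm (A i) (δ j)) ⟨δ, A i ⟩

-- mix X x y agrees with x outside X and with y on X.
mix : ∀ {n} → Vector Bool n → Vector Bool n → Vector Bool n → Vector Bool n
mix X x y j = x j xor (X j ∧ (x j xor y j))

-- mix is a congruence (X, x and y are explicit: mix is not injective, so
-- they cannot be inferred from the result).
mix-cong : ∀ {n} (X x y : Vector Bool n) {X′ x′ y′ : Vector Bool n} →
  X ≗ X′ → x ≗ x′ → y ≗ y′ → mix X x y ≗ mix X′ x′ y′
mix-cong X x y X≗X′ x≗x′ y≗y′ j rewrite X≗X′ j | x≗x′ j | y≗y′ j = refl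

-- Bitwise laws of mix: mixing twice composes the two sets, and mixing twice
-- by the same set undoes it.
mix-compose : ∀ s t x y →
  (x xor (s ∧ (x xor y))) xor (t ∧ ((x xor (s ∧ (x xor y))) xor (y xor (s ∧ (y xor x)))))
    ≡ x xor ((s xor t) ∧ (x xor y))
mix-compose = solve-∀ GF2

mix-involutive : ∀ s x y →
  (x xor (s ∧ (x xor y))) xor (s ∧ ((x xor (s ∧ (x xor y))) xor (y xor (s ∧ (y xor x))))) ≡ x
mix-involutive = solve-∀ GF2

_⟶[_]_ : ∀ {n} → Adj n → Vector Bool n → Adj n → Set
_⟶[_]_ {n} A X B = (z : Vector Bool n) → B · mix X z (A · z) ≗ mix X (A · z) z

⟶-refl : ∀ {n} (A : Adj n) → A ⟶[ (λ _ → false) ] A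
⟶-refl A z i = trans (·-cong A {mix (λ _ → false) z (A · z)} {z} (λ j → xor-identityʳ (z j)) i)
                     (sym (xor-identityʳ ((A · z) i)))

⟶-cong : ∀ {n} {A B : Adj n} {X Y : Vector Bool n} → X ≗ Y → A ⟶[ X ] B → A ⟶[ Y ] B
⟶-cong {A = A} {B} {X} {Y} X≗Y A⟶B z i = begin
  (B · mix Y z (A · z)) i ≡⟨ ·-cong B (mix-cong Y z (A · z) (λ j → sym (X≗Y j)) (λ _ → refl) (λ _ → refl)) i ⟩
  (B · mix X z (A · z)) i ≡⟨ A⟶B z i ⟩
  mix X (A · z) z i       ≡⟨ mix-cong X (A · z) z X≗Y (λ _ → refl) (λ _ → refl) i ⟩
  mix Y (A · z) z i       ∎

⟶-trans : ∀ {n} {A B C : Adj n} {X Y : Vector Bool n} → A ⟶[ X ] B → B ⟶[ Y ] C → A ⟶[ X +ᵛ Y ] C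
⟶-trans {n} {A} {B} {C} {X} {Y} A⟶B B⟶C z i = begin
  (C · mix (X +ᵛ Y) z (A · z)) i ≡⟨ ·-cong C (λ j → sym (mix-compose (X j) (Y j) (z j) ((A · z) j))) i ⟩
  (C · mix Y p q) i               ≡⟨ ·-cong C (mix-cong Y p q (λ _ → refl) (λ _ → refl) (λ j → sym (A⟶B z j))) i ⟩
  (C · mix Y p (B · p)) i         ≡⟨ B⟶C p i ⟩
  mix Y (B · p) p i               ≡⟨ mix-cong Y (B · p) p (λ _ → refl) (A⟶B z) (λ _ → refl) i ⟩
  mix Y q p i                     ≡⟨ mix-compose (X i) (Y i) ((A · z) i) (z i) ⟩
  mix (X +ᵛ Y) (A · z) z i        ∎
  where
  p q : Vector Bool n
  p = mix X z (A · z)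
  q = mix X (A · z) z

⟶-determines : ∀ {n} {A B C : Adj n} {X : Vector Bool n} → B ⟶[ X ] A → A ⟶[ X ] C → B ≡ᴹ C
⟶-determines {n} {A} {B} {C} {X} B⟶A A⟶C i j = begin
  B i j       ≡⟨ sym (·-δ B i j) ⟩
  (B · δ j) i ≡⟨ sym (same-action (δ j) i) ⟩
  (C · δ j) i ≡⟨ ·-δ C i j ⟩
  C i j       ∎
  where
  -- p is recovered by mixing z = mix X p (B p) with A z = mix X (B p) p.
  same-action : ∀ p → C · p ≗ B · p
  same-action p i = begin
    (C · p) i                   ≡⟨ ·-cong C p≗ i ⟩
    (C · mix X z (A · z)) i     ≡⟨ A⟶C z i ⟩
    mix X (A · z) z i           ≡⟨ mix-cong X (A · z) z (λ _ → refl) (B⟶A p) (λ _ → refl) i ⟩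
    mix X (mix X (B · p) p) z i ≡⟨ mix-involutive (X i) ((B · p) i) (p i) ⟩
    (B · p) i                   ∎
    where
    z : Vector Bool n
    z = mix X p (B · p)
    p≗ : p ≗ mix X z (A · z)
    p≗ k = trans (sym (mix-involutive (X k) (p k) ((B · p) k)))
                 (mix-cong X z (mix X (B · p) p) (λ _ → refl) (λ _ → refl) (λ l → sym (B⟶A p l)) k)

-- If H ⟶[ X ] G and u ∈ X is not a loop of G, then row u of G meets X:
-- otherwise G would send the vector mix X (δ u) (H δ u) to a vector that is
-- zero at u, whereas the relation says that its u-th entry is δ u u = 1.
neighbour-in-support : ∀ {n} {H G : Adj n} {X : Vector Bool n} {u : Fin n} →
  H ⟶[ X ] G → G u u ≡ false → X u ≡ true → ∃ λ v → X v ≡ true × G u v ≡ true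
neighbour-in-support {n} {H} {G} {X} {u} H⟶G Guu Xu
  with any? (λ v → (X v Bool.≟ true) ×-dec (G u v Bool.≟ true))
... | yes found = found
... | no none   = ⊥-elim (false≢true (begin
  false                       ≡⟨ sym (sum-replicate-zero n) ⟩
  sum {n} (λ _ → false)       ≡⟨ sum-cong-≗ {n} vanishes ⟩
  (G · mix X p (H · p)) u     ≡⟨ H⟶G p u ⟩
  mix X (H · p) p u           ≡⟨ cong₂ (λ s d → h xor (s ∧ (h xor d))) Xu (δ-refl u) ⟩
  h xor (h xor true)          ≡⟨ sym (xor-assoc h h true) ⟩
  (h xor h) xor true          ≡⟨ cong (_xor true) (xor-same h) ⟩
  true                        ∎))
  where
  p : Vector Bool n
  p = δ u
  h : Bool
  h = (H · p) u
  vanishes : ∀ j → false ≡ G u j ∧ mix X p (H · p) j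
  vanishes j with G u j in Guj | X j in Xj
  ... | false | _     = refl
  ... | true  | true  = ⊥-elim (none (j , Xj , Guj))
  ... | true  | false = sym (trans (xor-identityʳ (δ u j))
                                   (δ-other (λ { refl → false≢true (trans (sym Guu) Guj) })))

_⇄[_]_ : ∀ {n} → Adj n → Vector Bool n → Adj n → Set
A ⇄[ X ] B = A ⟶[ X ] B × B ⟶[ X ] A

⇄-refl : ∀ {n} (A : Adj n) → A ⇄[ (λ _ → false) ] A
⇄-refl A = ⟶-refl A , ⟶-refl A

⇄-sym : ∀ {n} {A B : Adj n} {X : Vector Bool n} → A ⇄[ X ] B → B ⇄[ X ] A
⇄-sym (A⟶B , B⟶A) = B⟶A , A⟶B

⇄-cong : ∀ {n} {A B : Adj n} {X Y : Vector Bool n} → X ≗ Y → A ⇄[ X ] B → A ⇄[ Y ] B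
⇄-cong X≗Y (A⟶B , B⟶A) = ⟶-cong X≗Y A⟶B , ⟶-cong X≗Y B⟶A

⇄-trans : ∀ {n} {A B C : Adj n} {X Y : Vector Bool n} → A ⇄[ X ] B → B ⇄[ Y ] C → A ⇄[ X +ᵛ Y ] C
⇄-trans {X = X} {Y} (A⟶B , B⟶A) (B⟶C , C⟶B) =
  ⟶-trans A⟶B B⟶C , ⟶-cong (λ i → xor-comm (Y i) (X i)) (⟶-trans C⟶B B⟶A)

-- The closed neighbourhood N'(u) of a loopless graph, as δ u + row u.
nbhd : ∀ {n} → Adj n → Fin n → Vector Bool n
nbhd A u x = δ u x xor A u x

N'≡nbhd : ∀ {n} {G : Adj n} → (∀ x → G x x ≡ false) → ∀ u → N' G u ≗ nbhd G u
N'≡nbhd loopless u x with x ≟ u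
... | yes refl = sym (cong not (loopless x))
... | no _     = refl

⟨nbhd⟩ : ∀ {n} (A : Adj n) (u : Fin n) (z : Vector Bool n) → ⟨ nbhd A u , z ⟩ ≡ z u xor (A · z) u
⟨nbhd⟩ A u z = trans (⟨⟩-+ˡ (δ u) (A u) z) (cong (_xor (A · z) u) ⟨δ, z ⟩)

mix-pair : ∀ {n} (u v : Fin n) (x y : Vector Bool n) (j : Fin n) →
  mix (pair u v) x y j ≡ x j xor ((δ u j ∧ (x u xor y u)) xor (δ v j ∧ (x v xor y v)))
mix-pair u v x y j = cong (x j xor_) (begin
  (δ u j xor δ v j) ∧ (x +ᵛ y) j
    ≡⟨ ∧-distribʳ-xor ((x +ᵛ y) j) (δ u j) (δ v j) ⟩
  (δ u j ∧ (x +ᵛ y) j) xor (δ v j ∧ (x +ᵛ y) j)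
    ≡⟨ cong₂ _xor_ (δ-subst u j (x +ᵛ y)) (δ-subst v j (x +ᵛ y)) ⟩
  (δ u j ∧ (x u xor y u)) xor (δ v j ∧ (x v xor y v)) ∎)

rank2 : ∀ {n} → Adj n → Vector Bool n → Vector Bool n → Adj n
rank2 A a b x y = A x y xor ((a x ∧ b y) xor (b x ∧ a y))

rank2-cong : ∀ {n} (A : Adj n) {a a′ b b′ : Vector Bool n} → a ≗ a′ → b ≗ b′ → rank2 A a b ≡ᴹ rank2 A a′ b′
rank2-cong A a≗a′ b≗b′ x y rewrite a≗a′ x | a≗a′ y | b≗b′ x | b≗b′ y = refl

rank2-· : ∀ {n} (A : Adj n) (a b p : Vector Bool n) (i : Fin n) →
  (rank2 A a b · p) i ≡ (A · p) i xor ((a i ∧ ⟨ b , p ⟩) xor (b i ∧ ⟨ a , p ⟩))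
rank2-· A a b p i = begin
  ⟨ A i +ᵛ (ab +ᵛ ba) , p ⟩
    ≡⟨ trans (⟨⟩-+ˡ (A i) (ab +ᵛ ba) p) (cong ((A · p) i xor_) (⟨⟩-+ˡ ab ba p)) ⟩
  (A · p) i xor (⟨ ab , p ⟩ xor ⟨ ba , p ⟩)
    ≡⟨ cong ((A · p) i xor_) (cong₂ _xor_ (⟨⟩-scaleˡ (a i) b p) (⟨⟩-scaleˡ (b i) a p)) ⟩
  (A · p) i xor ((a i ∧ ⟨ b , p ⟩) xor (b i ∧ ⟨ a , p ⟩)) ∎
  where
  ab ba : Vector Bool _
  ab y = a i ∧ b y
  ba y = b i ∧ a y

IsSimple-≡ᴹ : ∀ {n} {A B : Adj n} → A ≡ᴹ B → IsSimple B → IsSimple A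
IsSimple-≡ᴹ A≡B simple = record
  { sym      = λ x y → trans (A≡B x y) (trans (IsSimple.sym simple x y) (sym (A≡B y x)))
  ; loopless = λ x → trans (A≡B x x) (IsSimple.loopless simple x)
  }

rank2-simple : ∀ {n} {A : Adj n} → IsSimple A → (a b : Vector Bool n) → IsSimple (rank2 A a b)
rank2-simple simple a b = record
  { sym      = λ x y → cong₂ _xor_ (IsSimple.sym simple x y) (swap (a x) (b y) (b x) (a y))
  ; loopless = λ x → cong₂ _xor_ (IsSimple.loopless simple x)
                       (trans (cong ((a x ∧ b x) xor_) (∧-comm (b x) (a x))) (xor-same (a x ∧ b x)))
  }
  where
  swap : ∀ p q r s → (p ∧ q) xor (r ∧ s) ≡ (s ∧ r) xor (q ∧ p)
  swap = solve-∀ GF2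

-- The pivot toggles {x, y} iff x and y lie in different classes among
-- N'(u) ∖ N'(v), N'(v) ∖ N'(u), N'(u) ∩ N'(v); in terms of the memberships
-- a = N'(u) and b = N'(v) this is a x b y + b x a y.
toggle≡rank2 : ∀ ax bx ay by →
  (ax ∨ bx) ∧ ((ay ∨ by) ∧ ((ax xor ay) ∨ (bx xor by))) ≡ (ax ∧ by) xor (bx ∧ ay)
toggle≡rank2 false false false false = refl
toggle≡rank2 false false false true  = refl
toggle≡rank2 false false true  false = refl
toggle≡rank2 false false true  true  = refl
toggle≡rank2 false true  false false = refl
toggle≡rank2 false true  false true  = refl
toggle≡rank2 false true  true  false = refl
toggle≡rank2 false true  true  true  = refl
toggle≡rank2 true  false false false = refl
toggle≡rank2 true  false false true  = refl
toggle≡rank2 true  false true  false = refl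
toggle≡rank2 true  false true  true  = refl
toggle≡rank2 true  true  false false = refl
toggle≡rank2 true  true  false true  = refl
toggle≡rank2 true  true  true  false = refl
toggle≡rank2 true  true  true  true  = refl

pivot≡rank2 : ∀ {n} {G : Adj n} → IsSimple G → (u v : Fin n) → pivot G u v ≡ᴹ rank2 G (nbhd G u) (nbhd G v)
pivot≡rank2 {G = G} simple u v x y =
  trans (cong (G x y xor_) (toggle≡rank2 (N' G u x) (N' G v x) (N' G u y) (N' G v y)))
        (rank2-cong G (N'≡nbhd (IsSimple.loopless simple) u) (N'≡nbhd (IsSimple.loopless simple) v) x y)

pivot-simple : ∀ {n} {G : Adj n} → IsSimple G → (u v : Fin n) → IsSimple (pivot G u v)
pivot-simple {G = G} simple u v =
  IsSimple-≡ᴹ (pivot≡rank2 simple u v) (rank2-simple simple (nbhd G u) (nbhd G v))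

edge-distinct : ∀ {n} {G : Adj n} → IsSimple G → {u v : Fin n} → G u v ≡ true → u ≢ v
edge-distinct simple {u} edge refl = false≢true (trans (sym (IsSimple.loopless simple u)) edge)

module PivotStep {n} {A : Adj n} (simple : IsSimple A) {u v : Fin n} (edge : A u v ≡ true)
                 (B : Adj n) (B≡ : B ≡ᴹ rank2 A (nbhd A u) (nbhd A v)) where

  a b : Vector Bool n
  a = nbhd A u
  b = nbhd A v

  u≢v : u ≢ v
  u≢v = edge-distinct simple edge

  a-u : a u ≡ true
  a-u = cong₂ _xor_ (δ-refl u) (IsSimple.loopless simple u)
  a-v : a v ≡ true
  a-v = cong₂ _xor_ (δ-other (λ v≡u → u≢v (sym v≡u))) edge
  b-u : b u ≡ true
  b-u = cong₂ _xor_ (δ-other u≢v) (trans (IsSimple.sym simple v u) edge)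
  b-v : b v ≡ true
  b-v = cong₂ _xor_ (δ-refl v) (IsSimple.loopless simple v)

  -- The main computation: with w = A z, the vector P = mix {u,v} z w is z
  -- corrected by α at u and by β at v, and then B P = w + α δ u + β δ v.
  module Image (z : Vector Bool n) where
    w : Vector Bool n
    w = A · z
    α β : Bool
    α = z u xor w u
    β = z v xor w v
    P : Vector Bool n
    P = mix (pair u v) z w

    ⟨_,P⟩ : ∀ (f : Vector Bool n) → ⟨ f , P ⟩ ≡ ⟨ f , z ⟩ xor ((f u ∧ α) xor (f v ∧ β))
    ⟨ f ,P⟩ = trans (⟨⟩-congʳ f (mix-pair u v z w)) (⟨⟩-two-point f z u v α β)

    ⟨b,P⟩ : ⟨ b , P ⟩ ≡ α
    ⟨b,P⟩ = begin
      ⟨ b , P ⟩                                  ≡⟨ ⟨ b ,P⟩ ⟩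
      ⟨ b , z ⟩ xor ((b u ∧ α) xor (b v ∧ β))    ≡⟨ cong₂ (λ s t → s xor t) (⟨nbhd⟩ A v z)
                                                          (cong₂ (λ s t → (s ∧ α) xor (t ∧ β)) b-u b-v) ⟩
      β xor (α xor β)                            ≡⟨ cancel β α ⟩
      α                                          ∎
      where
      cancel : ∀ s t → s xor (t xor s) ≡ t
      cancel = solve-∀ GF2

    ⟨a,P⟩ : ⟨ a , P ⟩ ≡ β
    ⟨a,P⟩ = begin
      ⟨ a , P ⟩                                  ≡⟨ ⟨ a ,P⟩ ⟩
      ⟨ a , z ⟩ xor ((a u ∧ α) xor (a v ∧ β))    ≡⟨ cong₂ (λ s t → s xor t) (⟨nbhd⟩ A u z)
                                                          (cong₂ (λ s t → (s ∧ α) xor (t ∧ β)) a-u a-v) ⟩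
      α xor (α xor β)                            ≡⟨ cancel α β ⟩
      β                                          ∎
      where
      cancel : ∀ s t → s xor (s xor t) ≡ t
      cancel = solve-∀ GF2

  forward : A ⟶[ pair u v ] B
  forward z i = begin
    (B · P) i
      ≡⟨ ·-congᴹ B≡ P i ⟩
    (rank2 A a b · P) i
      ≡⟨ rank2-· A a b P i ⟩
    (A · P) i xor ((a i ∧ ⟨ b , P ⟩) xor (b i ∧ ⟨ a , P ⟩))
      ≡⟨ cong₂ _xor_ ⟨ A i ,P⟩ (cong₂ (λ s t → (a i ∧ s) xor (b i ∧ t)) ⟨b,P⟩ ⟨a,P⟩) ⟩
    (w i xor ((A i u ∧ α) xor (A i v ∧ β))) xor ((a i ∧ α) xor (b i ∧ β))
      ≡⟨ cong₂ (λ s t → (w i xor ((A i u ∧ α) xor (A i v ∧ β))) xor ((s ∧ α) xor (t ∧ β)))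
               (cong (δ u i xor_) (IsSimple.sym simple u i)) (cong (δ v i xor_) (IsSimple.sym simple v i)) ⟩
    (w i xor ((A i u ∧ α) xor (A i v ∧ β))) xor (((δ u i xor A i u) ∧ α) xor ((δ v i xor A i v) ∧ β))
      ≡⟨ absorb (w i) α β (A i u) (A i v) (δ u i) (δ v i) ⟩
    w i xor ((δ u i ∧ α) xor (δ v i ∧ β))
      ≡⟨ cong₂ (λ s t → w i xor ((δ u i ∧ s) xor (δ v i ∧ t))) (xor-comm (z u) (w u)) (xor-comm (z v) (w v)) ⟩
    w i xor ((δ u i ∧ (w u xor z u)) xor (δ v i ∧ (w v xor z v)))
      ≡⟨ sym (mix-pair u v w z i) ⟩
    mix (pair u v) w z i ∎
    where
    open Image z
    absorb : ∀ w α β p q d e →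
      (w xor ((p ∧ α) xor (q ∧ β))) xor (((d xor p) ∧ α) xor ((e xor q) ∧ β)) ≡ w xor ((d ∧ α) xor (e ∧ β))
    absorb = solve-∀ GF2

  -- B is again simple with the edge uv, and its closed neighbourhoods of u and
  -- v are those of v and u in A; consequently A is the same update of B.
  B-simple : IsSimple B
  B-simple = IsSimple-≡ᴹ B≡ (rank2-simple simple a b)

  B-edge : B u v ≡ true
  B-edge = trans (B≡ u v) (cong₂ _xor_ edge (cong₂ _xor_ (cong₂ _∧_ a-u b-v) (cong₂ _∧_ b-u a-v)))

  B-nbhd-u : nbhd B u ≗ b
  B-nbhd-u x = begin
    δ u x xor B u x                                      ≡⟨ cong (δ u x xor_) (B≡ u x) ⟩
    δ u x xor (A u x xor ((a u ∧ b x) xor (b u ∧ a x)))  ≡⟨ cong₂ (λ s t → δ u x xor (A u x xor ((s ∧ b x) xor (t ∧ a x)))) a-u b-u ⟩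
    δ u x xor (A u x xor (b x xor (δ u x xor A u x)))    ≡⟨ cancel (δ u x) (A u x) (b x) ⟩
    b x                                                  ∎
    where
    cancel : ∀ d g c → d xor (g xor (c xor (d xor g))) ≡ c
    cancel = solve-∀ GF2

  B-nbhd-v : nbhd B v ≗ a
  B-nbhd-v x = begin
    δ v x xor B v x                                      ≡⟨ cong (δ v x xor_) (B≡ v x) ⟩
    δ v x xor (A v x xor ((a v ∧ b x) xor (b v ∧ a x)))  ≡⟨ cong₂ (λ s t → δ v x xor (A v x xor ((s ∧ b x) xor (t ∧ a x)))) a-v b-v ⟩
    δ v x xor (A v x xor ((δ v x xor A v x) xor a x))    ≡⟨ cancel (δ v x) (A v x) (a x) ⟩
    a x                                                  ∎
    where
    cancel : ∀ d g c → d xor (g xor ((d xor g) xor c)) ≡ c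
    cancel = solve-∀ GF2

  A≡ : A ≡ᴹ rank2 B (nbhd B u) (nbhd B v)
  A≡ x y = sym (begin
    B x y xor ((nbhd B u x ∧ nbhd B v y) xor (nbhd B v x ∧ nbhd B u y))
      ≡⟨ cong₂ _xor_ (B≡ x y) (cong₂ _xor_ (cong₂ _∧_ (B-nbhd-u x) (B-nbhd-v y)) (cong₂ _∧_ (B-nbhd-v x) (B-nbhd-u y))) ⟩
    (A x y xor ((a x ∧ b y) xor (b x ∧ a y))) xor ((b x ∧ a y) xor (a x ∧ b y))
      ≡⟨ cancel (A x y) (a x ∧ b y) (b x ∧ a y) ⟩
    A x y ∎)
    where
    cancel : ∀ g p q → (g xor (p xor q)) xor (q xor p) ≡ g
    cancel = solve-∀ GF2

pivot-⇄ : ∀ {n} {G : Adj n} → IsSimple G → {u v : Fin n} → G u v ≡ true → G ⇄[ pair u v ] pivot G u v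
pivot-⇄ {G = G} simple {u} {v} edge = forward , Back.forward
  where
  open PivotStep simple edge (pivot G u v) (pivot≡rank2 simple u v)
  module Back = PivotStep B-simple B-edge G A≡

supp : ∀ {n} → PivotSeq n → Vector Bool n
supp φ i = lookup (sup φ) i

lookup-⁅⁆ : ∀ {n} (u i : Fin n) → lookup ⁅ u ⁆ i ≡ δ u i
lookup-⁅⁆ zero    zero    = refl
lookup-⁅⁆ zero    (suc i) = lookup-replicate i false
lookup-⁅⁆ (suc u) zero    = refl
lookup-⁅⁆ (suc u) (suc i) = trans (lookup-⁅⁆ u i) (sym (δ-suc u i))

supp-∷ : ∀ {n} (u v : Fin n) (φ : PivotSeq n) → supp ((u , v) ∷ φ) ≗ pair u v +ᵛ supp φ
supp-∷ u v φ i = begin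
  lookup (⁅ u ⁆ ⊕ (⁅ v ⁆ ⊕ sup φ)) i
    ≡⟨ lookup-zipWith _xor_ i ⁅ u ⁆ (⁅ v ⁆ ⊕ sup φ) ⟩
  lookup ⁅ u ⁆ i xor lookup (⁅ v ⁆ ⊕ sup φ) i
    ≡⟨ cong₂ _xor_ (lookup-⁅⁆ u i)
                   (trans (lookup-zipWith _xor_ i ⁅ v ⁆ (sup φ)) (cong (_xor supp φ i) (lookup-⁅⁆ v i))) ⟩
  δ u i xor (δ v i xor supp φ i)
    ≡⟨ sym (xor-assoc (δ u i) (δ v i) (supp φ i)) ⟩
  pair u v i xor supp φ i ∎

apply-⇄ : ∀ {n} {G : Adj n} → IsSimple G → (φ : PivotSeq n) → Applicable G φ → G ⇄[ supp φ ] apply G φ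
apply-⇄ {G = G} simple []            _ = ⇄-cong (λ i → sym (lookup-replicate i false)) (⇄-refl G)
apply-⇄         simple ((u , v) ∷ φ) (edge , rest) =
  ⇄-cong (λ i → sym (supp-∷ u v φ i))
         (⇄-trans (pivot-⇄ simple edge) (apply-⇄ (pivot-simple simple u v) φ rest))

weight : ∀ {n} → Vector Bool n → ℕ
weight X = ∣ tabulate X ∣

∈-tabulate : ∀ {n} {X : Vector Bool n} {x : Fin n} → x ∈ₛ tabulate X → X x ≡ true
∈-tabulate {X = X} {x} m = trans (sym (lookup∘tabulate X x)) ([]=⇒lookup m)

tabulate-∈ : ∀ {n} {X : Vector Bool n} {x : Fin n} → X x ≡ true → x ∈ₛ tabulate X
tabulate-∈ {X = X} {x} Xx = lookup⇒[]= x (tabulate X) (trans (lookup∘tabulate X x) Xx)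

weight-< : ∀ {n} {X Y : Vector Bool n} (u : Fin n) →
  (∀ i → Y i ≡ true → X i ≡ true) → Y u ≡ false → X u ≡ true → weight Y < weight X
weight-< u Y⊆X Yu Xu = p⊂q⇒∣p∣<∣q∣
  ( (λ m → tabulate-∈ (Y⊆X _ (∈-tabulate m)))
  , u , tabulate-∈ Xu , (λ m → false≢true (trans (sym Yu) (∈-tabulate m))) )

module Removal {n} {X : Vector Bool n} {u v : Fin n} (u≢v : u ≢ v) (Xu : X u ≡ true) (Xv : X v ≡ true) where

  removed-u : (pair u v +ᵛ X) u ≡ false
  removed-u = cong₂ _xor_ (cong₂ _xor_ (δ-refl u) (δ-other u≢v)) Xu

  removed-v : (pair u v +ᵛ X) v ≡ false
  removed-v = cong₂ _xor_ (cong₂ _xor_ (δ-other (λ v≡u → u≢v (sym v≡u))) (δ-refl v)) Xv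

  removed-⊆ : ∀ i → (pair u v +ᵛ X) i ≡ true → X i ≡ true
  removed-⊆ i X′i with i ≟ u | i ≟ v
  ... | yes refl | _        = Xu
  ... | no _     | yes refl = Xv
  ... | no _     | no _     = X′i

record Realisation {n} (G : Adj n) (X : Vector Bool n) : Set where
  field
    seq        : PivotSeq n
    reduced    : Reduced seq
    applicable : Applicable G seq
    support    : supp seq ≗ X
    within     : ∀ {x} → x ∈ vertices seq → X x ≡ true

  absent : ∀ {x} → X x ≡ false → All (x ≢_) (vertices seq)
  absent Xx = All.tabulate (λ { m refl → false≢true (trans (sym Xx) (within m)) })

-- Every X by which G is related to some H is realised: pick u ∈ X, a
-- neighbour v ∈ X of u, pivot on uv and realise X + {u, v} in G[uv].
realise : ∀ {n} {G H : Adj n} {X : Vector Bool n} →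
  IsSimple G → G ⇄[ X ] H → Acc _<_ (weight X) → Realisation G X
realise {n} {G} {H} {X} simple G⇄H (acc smaller) with any? (λ u → X u Bool.≟ true)
... | no X-empty = record
  { seq        = []
  ; reduced    = []
  ; applicable = tt
  ; support    = λ i → trans (lookup-replicate i false) (sym (¬-not (λ Xi → X-empty (i , Xi))))
  ; within     = λ ()
  }
... | yes (u , Xu) = extend (neighbour-in-support (proj₂ G⇄H) (IsSimple.loopless simple u) Xu)
  where
  extend : (∃ λ v → X v ≡ true × G u v ≡ true) → Realisation G X
  extend (v , Xv , edge) = record
    { seq        = (u , v) ∷ R.seq
    ; reduced    = (u≢v All.∷ R.absent removed-u) ∷ (R.absent removed-v ∷ R.reduced)
    ; applicable = edge , R.applicable
    ; support    = λ i → trans (supp-∷ u v R.seq i) (trans (cong (pair u v i xor_) (R.support i))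
                                                          (toggle-twice (pair u v i) (X i)))
    ; within     = λ { (here refl) → Xu ; (there (here refl)) → Xv ; (there (there m)) → removed-⊆ _ (R.within m) }
    }
    where
    u≢v : u ≢ v
    u≢v = edge-distinct simple edge
    open Removal u≢v Xu Xv
    R : Realisation (pivot G u v) (pair u v +ᵛ X)
    R = realise (pivot-simple simple u v) (⇄-trans (⇄-sym (pivot-⇄ simple edge)) G⇄H)
                (smaller (weight-< u removed-⊆ removed-u Xu))
    module R = Realisation R
    toggle-twice : ∀ p x → p xor (p xor x) ≡ x
    toggle-twice p x = trans (sym (xor-assoc p p x)) (cong (_xor x) (xor-same p))

lookup-ext : ∀ {n} {xs ys : Vec Bool n} → (∀ i → lookup xs i ≡ lookup ys i) → xs ≡ ys
lookup-ext {xs = xs} {ys} eq = begin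
  xs                   ≡⟨ sym (tabulate∘lookup xs) ⟩
  tabulate (lookup xs) ≡⟨ tabulate-cong eq ⟩
  tabulate (lookup ys) ≡⟨ tabulate∘lookup ys ⟩
  ys                   ∎

theorem5 : (n : ℕ) (G : Adj n) → IsSimple G → (φ : PivotSeq n) → Applicable G φ →
    Σ (PivotSeq n) (λ φ′ → Reduced φ′ × Applicable G φ′ × sup φ ≡ sup φ′ ×
      ((x y : Fin n) → apply G φ x y ≡ apply G φ′ x y))
theorem5 n G simple φ app = seq , reduced , applicable , lookup-ext (λ i → sym (support i)) , same-result
  where
  G⇄Gφ : G ⇄[ supp φ ] apply G φ
  G⇄Gφ = apply-⇄ simple φ app
  open Realisation (realise simple G⇄Gφ (<-wellFounded (weight (supp φ))))
  -- G is related to G φ′ by the same set, and the related graph is unique.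
  same-result : (x y : Fin n) → apply G φ x y ≡ apply G seq x y
  same-result = ⟶-determines (proj₂ G⇄Gφ) (⟶-cong support (proj₁ (apply-⇄ simple seq applicable)))
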